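{- In LP$^{\mathrm{MLN}}$ (i.e. with respect to semi-strong equivalence $\equiv_{s,s}$): the S-EX-0 transformation is neither SE-preserving nor NSE-preserving; and the S-EX-1 transformation is NSE-preserving but not SE-preserving.
   Context: Atoms are propositional. A rule $r$ is an expression $h_1\vee\cdots\vee h_k\leftarrow b_1,\dots,b_m,\mathit{not}\,c_1,\dots,\mathit{not}\,c_n$; write $H(r)$, $B^+(r)$, $B^-(r)$ for the sets of head, positive body and negative body atoms. A program is a finite set of rules. An interpretation $X$ satisfies $r$ iff $X\cap H(r)\neq\emptyset$ or $B^+(r)\not\subseteq X$ or $B^-(r)\cap X\neq\emptyset$. GL-reduct $P^X=\{H(r)\leftarrow B^+(r) : r\in P,\ B^-(r)\cap X=\emptyset\}$; $X$ is an ASP stable model of $P$ iff $X\models P^X$ and no proper subset of $X$ satisfies $P^X$. Weights of LP$^{\mathrm{MLN}}$ rules are omitted; $X$ is an LP$^{\mathrm{MLN}}$ stable model of $P$ iff $X$ is an ASP stable model of $\{r\in P: X\models r\}$. $P\equiv_{s,s}Q$ iff for every program $R$, $P\cup R$ and $Q\cup R$ have the same LP$^{\mathrm{MLN}}$ stable models. Programs are regarded as tuples of rules; $\langle P,Q\rangle$ is the concatenation. For a tuple $T=\langle r_1,\dots,r_n\rangle$ with atom set $at(T)$, let $\langle S_1,\dots,S_{3n}\rangle=\langle H(r_1),B^+(r_1),B^-(r_1),\dots,H(r_n),B^+(r_n),B^-(r_n)\rangle$; for nonempty $N'\subseteq\{1,\dots,3n\}$ the independent set is $I_{N'}=\bigcap_{i\in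 N'}S_i\setminus\bigcup_{j\notin N'}S_j$. For $i\in\{0,1\}$, the S-EX-$i$ transformation takes an independent set $I_{N'}$ with $|I_{N'}|=i$ and a fresh atom $a'\notin at(T)$ and adds $a'$ to each $S_j$ with $j\in N'$. For a pair $T=\langle P,Q\rangle$ the result is $\langle P^\oplus,Q^\oplus\rangle$ with $P^\oplus$ the first $|P|$ rules. A transformation type is SE-preserving if for every pair $\langle P,Q\rangle$ and every admissible application $P\equiv_{s,s}Q$ implies $P^\oplus\equiv_{s,s}Q^\oplus$, and NSE-preserving if $P\not\equiv_{s,s}Q$ implies $P^\oplus\not\equiv_{s,s}Q^\oplus$. -}

module Defs where

open import Data.Nat using (ℕ; _≟_)
open import Data.Bool using (Bool; true; false; if_then_else_)
open import Data.Fin using (Fin)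
open import Data.List using (List; []; _∷_; _++_; length; filter; map; tabulate; take; drop; lookup)
open import Data.List.Membership.Propositional using (_∈_; _∉_)
open import Data.List.Membership.DecPropositional _≟_ using (_∈?_)
open import Data.List.Relation.Unary.Any using (Any; any?)
open import Data.List.Relation.Unary.All using (All; all?)
open import Data.List.Relation.Binary.Subset.Propositional using (_⊆_)
open import Data.List.Relation.Unary.Unique.Propositional using (Unique)
open import Data.Product using (Σ; ∃; _×_; _,_)
open import Data.Sum using (_⊎_)
open import Relation.Nullary using (¬_; ¬?)
open import Relation.Nullary.Decidable using (_⊎-dec_)
open import Relation.Unary using (Decidable)
open import Relation.Binary.PropositionalEquality using (_≡_)
open import Function.Bundles using (_⇔_)

-- Atoms are natural numbers (an infinite supply, so fresh atoms exist).
Atom : Set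
Atom = ℕ

-- Sets of atoms / interpretations are represented by finite lists (membership only matters).
Interp : Set
Interp = List Atom

-- A rule  h1 ∨ ... ∨ hk ← b1,...,bm, not c1,...,not cn
record Rule : Set where
  constructor rule
  field
    H  : List Atom
    B⁺ : List Atom
    B⁻ : List Atom
open Rule public

Program : Set
Program = List Rule

Sat : Interp → Rule → Set
Sat X r = Any (_∈ X) (H r) ⊎ (¬ All (_∈ X) (B⁺ r)) ⊎ Any (_∈ X) (B⁻ r)

sat? : (X : Interp) → Decidable (Sat X)
sat? X r = any? (_∈? X) (H r) ⊎-dec (¬? (all? (_∈? X) (B⁺ r)) ⊎-dec any? (_∈? X) (B⁻ r))

Model : Interp → Program → Set
Model X P = All (Sat X) P

Blocked : Interp → Rule → Set
Blocked X r = Any (_∈ X) (B⁻ r)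

notBlocked? : (X : Interp) → Decidable (λ r → ¬ Blocked X r)
notBlocked? X r = ¬? (any? (_∈? X) (B⁻ r))

reduct : Program → Interp → Program
reduct P X = map (λ r → rule (H r) (B⁺ r) []) (filter (notBlocked? X) P)

Stable : Interp → Program → Set
Stable X P = Model X (reduct P X)
           × (∀ (Y : Interp) → Y ⊆ X → ¬ (X ⊆ Y) → ¬ Model Y (reduct P X))

satisfied : Interp → Program → Program
satisfied X P = filter (sat? X) P

MLNStable : Interp → Program → Set
MLNStable X P = Stable X (satisfied X P)

SSEquiv : Program → Program → Set
SSEquiv P Q = ∀ (R : Program) (X : Interp) → MLNStable X (P ++ R) ⇔ MLNStable X (Q ++ R)

-- The 3n sets S_1..S_{3n} are indexed by (k , c) with k : Fin n the rule
-- and c ∈ {head, pos, neg} the component (S_{3k-2}=H, S_{3k-1}=B⁺, S_{3k}=B⁻).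

data Part : Set where
  head pos neg : Part

component : Part → Rule → List Atom
component head r = H r
component pos  r = B⁺ r
component neg  r = B⁻ r

S : (T : Program) → Fin (length T) → Part → List Atom
S T k c = component c (lookup T k)

-- N' ⊆ {1..3n}, as a characteristic function
IndexSet : Program → Set
IndexSet T = Fin (length T) → Part → Bool

NonEmpty : (T : Program) → IndexSet T → Set
NonEmpty T N = ∃ λ k → ∃ λ c → N k c ≡ true

InIndep : (T : Program) → IndexSet T → Atom → Set
InIndep T N a = (∀ k c → N k c ≡ true → a ∈ S T k c)
              × (∀ k c → N k c ≡ false → a ∉ S T k c)

IndepCard : (T : Program) → IndexSet T → ℕ → Set
IndepCard T N i = Σ (List Atom) λ L → Unique L × length L ≡ i × (∀ a → a ∈ L ⇔ InIndep T N a)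

Fresh : Program → Atom → Set
Fresh T a = ∀ k c → a ∉ S T k c

addIf : Bool → Atom → List Atom → List Atom
addIf b a s = if b then a ∷ s else s

transform : (T : Program) → IndexSet T → Atom → Program
transform T N a = tabulate λ k →
  rule (addIf (N k head) a (H (lookup T k)))
       (addIf (N k pos)  a (B⁺ (lookup T k)))
       (addIf (N k neg)  a (B⁻ (lookup T k)))

leftPart : (P Q : Program) → IndexSet (P ++ Q) → Atom → Program
leftPart P Q N a = take (length P) (transform (P ++ Q) N a)

rightPart : (P Q : Program) → IndexSet (P ++ Q) → Atom → Program
rightPart P Q N a = drop (length P) (transform (P ++ Q) N a)

Admissible : ℕ → (P Q : Program) → IndexSet (P ++ Q) → Atom → Set
Admissible i P Q N a = NonEmpty (P ++ Q) N × IndepCard (P ++ Q) N i × Fresh (P ++ Q) a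

SEPreserving : ℕ → Set
SEPreserving i = ∀ (P Q : Program) (N : IndexSet (P ++ Q)) (a : Atom) →
  Admissible i P Q N a → SSEquiv P Q → SSEquiv (leftPart P Q N a) (rightPart P Q N a)

NSEPreserving : ℕ → Set
NSEPreserving i = ∀ (P Q : Program) (N : IndexSet (P ++ Q)) (a : Atom) →
  Admissible i P Q N a → ¬ SSEquiv P Q → ¬ SSEquiv (leftPart P Q N a) (rightPart P Q N a)

{-# OPTIONS --safe #-}
module Submission where

-- LP^MLN stability is decided by reduct models: X is stable for T iff no proper subset of X
-- satisfies the positive parts of those rules of T that X satisfies and does not block.
--
-- S-EX-0 may put the fresh atom into an empty independent set. Putting it into the empty
-- head of the constraint ← turns one copy of ⟨←⟩ into a fact, breaking a trivial
-- equivalence; putting it into both head and body of the fact 0 ← gives the tautology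
-- 1 ∨ 0 ← 1, equivalent to the empty program although 0 ← is not.
--
-- S-EX-1 with independent set {b} adds the fresh atom a exactly to components containing b,
-- so under the bridge a ← b, b ← a every rule of P⊕ evaluates like its original in P.
-- Given a context R and an interpretation X, first transpose a with an atom c occurring
-- nowhere, which frees a; then X is stable for P ∪ R iff the transposed X, extended by a
-- when it contains b, is stable for P⊕ ∪ (transposed R) ∪ bridge, and likewise for Q. So
-- an equivalence of P⊕ and Q⊕ transfers back to P and Q.
--
-- S-EX-1 does not preserve equivalence: ⟨0 ←, 0 ∨ 1 ←⟩ ≡ ⟨0 ← 1, 0 ∨ 1 ←⟩, but copying 1
-- to 2 gives ⟨0 ←, 2 ∨ 0 ∨ 1 ←⟩ and ⟨0 ← 2, 1, 2 ∨ 0 ∨ 1 ←⟩, and under R = ⟨1 ←⟩ the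
-- interpretation {0, 1} is stable only for the former.

open import Defs
open import Data.Bool using (true; false)
import Data.Bool as Bool
open import Data.Empty using (⊥-elim)
open import Data.Fin using (Fin; zero; suc)
import Data.Fin.Properties as Fin
open import Data.List using (List; []; _∷_; _++_; map; filter; length; take; drop; lookup)
open import Data.List.Properties using (map-++; map-id-local; map-∘; ++-assoc)
open import Data.List.Extrema.Nat using (max; xs≤max)
open import Data.Nat using (suc; _≟_)
open import Data.Nat.Properties using (1+n≰n)
open import Data.List.Membership.Propositional using (_∈_; _∉_; find; lose)
open import Data.List.Membership.Propositional.Properties
  using (∈-map⁺; ∈-map⁻; ∈-filter⁺; ∈-filter⁻; ∈-++⁺ˡ; ∈-++⁺ʳ)
open import Data.List.Membership.DecPropositional _≟_ using (_∈?_)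
open import Data.List.Relation.Unary.Any as Any using (Any; here; there; any?)
import Data.List.Relation.Unary.Any.Properties as Anyₚ
open import Data.List.Relation.Unary.All as All using (All; []; _∷_; all?)
import Data.List.Relation.Unary.All.Properties as Allₚ
open import Data.List.Relation.Unary.AllPairs using ([]; _∷_)
open import Data.List.Relation.Binary.Pointwise as Pointwise using (Pointwise; []; _∷_)
open import Data.List.Relation.Binary.Subset.Propositional using (_⊆_)
import Data.List.Relation.Binary.Subset.Propositional.Properties as ⊆
open import Data.Product using (_×_; _,_; proj₁; proj₂)
import Data.Product as Product
open import Data.Sum using (_⊎_; inj₁; inj₂)
import Data.Sum as Sum
open import Function using (_∘_; _∘₂_)
open import Function.Bundles using (_⇔_; mk⇔; Equivalence)
open import Function.Construct.Identity using (⇔-id)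
open import Function.Construct.Symmetry using (⇔-sym)
open import Function.Construct.Composition using (_⇔-∘_)
open import Function.Properties.Equivalence using (⇔-setoid)
open import Level using (0ℓ)
open import Relation.Binary.PropositionalEquality
  using (_≡_; _≢_; refl; sym; trans; cong; subst; subst₂)
import Relation.Binary.Reasoning.Setoid as SetoidReasoning
open import Relation.Nullary using (¬_; Dec; yes; no)
open import Relation.Nullary.Decidable
  using (_×-dec_; _→-dec_; _⊎-dec_; ¬?; map′; toWitness; toWitnessFalse)
open import Relation.Unary using (Decidable)

open Equivalence using (to; from)
open SetoidReasoning (⇔-setoid 0ℓ)

all-map⇔ : ∀ {A B : Set} {P : B → Set} {f : A → B} {xs} → All P (map f xs) ⇔ All (P ∘ f) xs
all-map⇔ = mk⇔ Allₚ.map⁻ Allₚ.map⁺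

all-cong-local : ∀ {A : Set} {P Q : A → Set} {xs} →
                 (∀ {x} → x ∈ xs → P x ⇔ Q x) → All P xs ⇔ All Q xs
all-cong-local P⇔Q = mk⇔ (λ ps → All.tabulate λ x∈xs → to (P⇔Q x∈xs) (All.lookup ps x∈xs))
                         (λ qs → All.tabulate λ x∈xs → from (P⇔Q x∈xs) (All.lookup qs x∈xs))

any-cong-local : ∀ {A : Set} {P Q : A → Set} {xs} →
                 (∀ {x} → x ∈ xs → P x ⇔ Q x) → Any P xs ⇔ Any Q xs
any-cong-local P⇔Q = mk⇔ (λ p → let _ , x∈xs , px = find p in lose x∈xs (to (P⇔Q x∈xs) px))
                         (λ q → let _ , x∈xs , qx = find q in lose x∈xs (from (P⇔Q x∈xs) qx))

all-filter⇔ : ∀ {A : Set} {P Q : A → Set} (P? : Decidable P) xs →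
              All Q (filter P? xs) ⇔ All (λ x → P x → Q x) xs
all-filter⇔ P? []       = mk⇔ (λ _ → []) (λ _ → [])
all-filter⇔ P? (x ∷ xs) with P? x | all-filter⇔ P? xs
... | yes p  | ih = mk⇔ (λ { (q ∷ qs) → (λ _ → q) ∷ to ih qs })
                        (λ { (f ∷ fs) → f p ∷ from ih fs })
... | no ¬p | ih = mk⇔ (λ qs → (⊥-elim ∘ ¬p) ∷ to ih qs)
                        (λ { (_ ∷ fs) → from ih fs })

pointwise-graph : ∀ {A B : Set} {R : A → B → Set} {f : A → B} →
                  (∀ x → R x (f x)) → ∀ xs → Pointwise R xs (map f xs)
pointwise-graph Rf []       = []
pointwise-graph Rf (x ∷ xs) = Rf x ∷ pointwise-graph Rf xs

pointwise-split : ∀ {A B : Set} {R : A → B → Set} xs {ys zs} → Pointwise R (xs ++ ys) zs →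
                  Pointwise R xs (take (length xs) zs) × Pointwise R ys (drop (length xs) zs)
pointwise-split []       rs       = [] , rs
pointwise-split (x ∷ xs) (r ∷ rs) = Product.map₁ (r ∷_) (pointwise-split xs rs)

rule-cong : ∀ {h h' p p' n n'} → h ≡ h' → p ≡ p' → n ≡ n' → rule h p n ≡ rule h' p' n'
rule-cong refl refl refl = refl

positivePart : Rule → Rule
positivePart r = rule (H r) (B⁺ r) []

Sat⁺ : Interp → Rule → Set
Sat⁺ Y r = Any (_∈ Y) (H r) ⊎ ¬ All (_∈ Y) (B⁺ r)

-- ReductModel X Y T is  Y ⊨ (satisfied X T)^X  unfolded rule by rule (reductModel⇔).
ReductSat : Interp → Interp → Rule → Set
ReductSat X Y r = Sat X r → ¬ Blocked X r → Sat⁺ Y r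

ReductModel : Interp → Interp → Program → Set
ReductModel X Y T = All (ReductSat X Y) T

Minimal : Interp → Program → Set
Minimal X T = ∀ Y → Y ⊆ X → ¬ X ⊆ Y → ¬ ReductModel X Y T

sat⁺⇔sat-positivePart : ∀ {Y r} → Sat⁺ Y r ⇔ Sat Y (positivePart r)
sat⁺⇔sat-positivePart = mk⇔ (Sum.map₂ inj₁) λ where
  (inj₁ h)        → inj₁ h
  (inj₂ (inj₁ b)) → inj₂ b
  (inj₂ (inj₂ ()))

sat-of-sat⁺ : ∀ {Y r} → Sat⁺ Y r → Sat Y r
sat-of-sat⁺ = Sum.map₂ inj₁

reductModel⇔ : ∀ X Y T → Model Y (reduct (satisfied X T) X) ⇔ ReductModel X Y T
reductModel⇔ X Y T = begin
  Model Y (reduct (satisfied X T) X)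
    ≈⟨ all-map⇔ ⟩
  All (Sat Y ∘ positivePart) (filter (notBlocked? X) (filter (sat? X) T))
    ≈⟨ all-filter⇔ (notBlocked? X) (filter (sat? X) T) ⟩
  All (λ r → ¬ Blocked X r → Sat Y (positivePart r)) (filter (sat? X) T)
    ≈⟨ all-filter⇔ (sat? X) T ⟩
  All (λ r → Sat X r → ¬ Blocked X r → Sat Y (positivePart r)) T
    ≈⟨ all-cong-local (λ {r} _ → mk⇔ (from (sat⁺⇔sat-positivePart {Y} {r}) ∘₂_)
                                     (to (sat⁺⇔sat-positivePart {Y} {r}) ∘₂_)) ⟩
  ReductModel X Y T ∎

reductModel-refl : ∀ X T → ReductModel X X T
reductModel-refl X T = All.tabulate λ _ → λ where
  (inj₁ h)        _  → inj₁ h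
  (inj₂ (inj₁ b)) _  → inj₂ b
  (inj₂ (inj₂ n)) nb → ⊥-elim (nb n)

mlnStable⇔minimal : ∀ {X T} → MLNStable X T ⇔ Minimal X T
mlnStable⇔minimal {X} {T} = mk⇔
  (λ (_ , least) Y Y⊆X X⊈Y m → least Y Y⊆X X⊈Y (from (reductModel⇔ X Y T) m))
  (λ minimal → from (reductModel⇔ X X T) (reductModel-refl X T)
             , λ Y Y⊆X X⊈Y m → minimal Y Y⊆X X⊈Y (to (reductModel⇔ X Y T) m))

reductModel⇒¬mlnStable : ∀ X T Y → Y ⊆ X → ¬ X ⊆ Y → ReductModel X Y T → ¬ MLNStable X T
reductModel⇒¬mlnStable X T Y Y⊆X X⊈Y m stable = to mlnStable⇔minimal stable Y Y⊆X X⊈Y m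

minimal-anti : ∀ {X T T'} → (∀ {Y} → Y ⊆ X → ReductModel X Y T' → ReductModel X Y T) →
               Minimal X T → Minimal X T'
minimal-anti T'⇒T minimal Y Y⊆X X⊈Y m = minimal Y Y⊆X X⊈Y (T'⇒T Y⊆X m)

ssEquiv-of-reductModels : ∀ {P Q} →
  (∀ {X Y} → Y ⊆ X → ReductModel X Y P → ReductModel X Y Q) →
  (∀ {X Y} → Y ⊆ X → ReductModel X Y Q → ReductModel X Y P) → SSEquiv P Q
ssEquiv-of-reductModels {P} {Q} P⇒Q Q⇒P R X = begin
  MLNStable X (P ++ R)  ≈⟨ mlnStable⇔minimal ⟩
  Minimal X (P ++ R)    ≈⟨ mk⇔ (minimal-anti (with-context Q⇒P)) (minimal-anti (with-context P⇒Q)) ⟩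
  Minimal X (Q ++ R)    ≈⟨ mlnStable⇔minimal ⟨
  MLNStable X (Q ++ R)  ∎
  where
  with-context : ∀ {T T'} → (∀ {X Y} → Y ⊆ X → ReductModel X Y T → ReductModel X Y T') →
                 ∀ {Y} → Y ⊆ X → ReductModel X Y (T ++ R) → ReductModel X Y (T' ++ R)
  with-context {T} T⇒T' Y⊆X m = Allₚ.++⁺ (T⇒T' Y⊆X (Allₚ.++⁻ˡ T m)) (Allₚ.++⁻ʳ T m)

ComponentsAgree : Interp → Interp → Rule → Rule → Set
ComponentsAgree Z Z' r r' = (Any (_∈ Z) (H r) ⇔ Any (_∈ Z') (H r'))
                          × (All (_∈ Z) (B⁺ r) ⇔ All (_∈ Z') (B⁺ r'))
                          × (Any (_∈ Z) (B⁻ r) ⇔ Any (_∈ Z') (B⁻ r'))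

componentsAgree-sym : ∀ {Z Z' r r'} → ComponentsAgree Z Z' r r' → ComponentsAgree Z' Z r' r
componentsAgree-sym (h , p , n) = ⇔-sym h , ⇔-sym p , ⇔-sym n

reductSat-transfer : ∀ {X X' Y Y' r r'} → ComponentsAgree X X' r r' → ComponentsAgree Y Y' r r' →
                     ReductSat X Y r → ReductSat X' Y' r'
reductSat-transfer (xh , xp , xn) (yh , yp , yn) sat s' nb' =
  Sum.map (to yh) (λ ¬b b' → ¬b (from yp b'))
    (sat (Sum.map (from xh) (Sum.map (λ ¬b b → ¬b (to xp b)) (from xn)) s') (nb' ∘ to xn))

Transferable : Interp → Interp → Interp → Interp → Rule → Rule → Set
Transferable X X' Y Y' r r' = ComponentsAgree X X' r r' × ComponentsAgree Y Y' r r'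

reductModel-transfer : ∀ {X X' Y Y' T T'} → Pointwise (Transferable X X' Y Y') T T' →
                       ReductModel X Y T → ReductModel X' Y' T'
reductModel-transfer []              []       = []
reductModel-transfer ((x , y) ∷ xys) (m ∷ ms) = reductSat-transfer x y m ∷ reductModel-transfer xys ms

reductModel-transfer⁻ : ∀ {X X' Y Y' T T'} → Pointwise (Transferable X X' Y Y') T T' →
                        ReductModel X' Y' T' → ReductModel X Y T
reductModel-transfer⁻ =
  reductModel-transfer ∘ Pointwise.symmetric (Product.map componentsAgree-sym componentsAgree-sym)

module Renaming (σ : Atom → Atom) (σ-involutive : ∀ x → σ (σ x) ≡ x) where

  renameRule : Rule → Rule
  renameRule r = rule (map σ (H r)) (map σ (B⁺ r)) (map σ (B⁻ r))

  rename : Program → Program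
  rename = map renameRule

  map-σ-involutive : ∀ L → map σ (map σ L) ≡ L
  map-σ-involutive L = trans (sym (map-∘ L)) (map-id-local (All.tabulate λ {x} _ → σ-involutive x))

  rename-involutive : ∀ T → rename (rename T) ≡ T
  rename-involutive T = trans (sym (map-∘ T)) (map-id-local (All.tabulate λ {r} _ →
    rule-cong (map-σ-involutive (H r)) (map-σ-involutive (B⁺ r)) (map-σ-involutive (B⁻ r))))

  ∈-map-σ⇔ : ∀ {x Z} → x ∈ map σ Z ⇔ σ x ∈ Z
  ∈-map-σ⇔ {x} {Z} = mk⇔ σx∈Z (subst (_∈ map σ Z) (σ-involutive x) ∘ ∈-map⁺ σ)
    where
    σx∈Z : x ∈ map σ Z → σ x ∈ Z
    σx∈Z x∈σZ with ∈-map⁻ σ x∈σZ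
    ... | y , y∈Z , refl = subst (_∈ Z) (sym (σ-involutive y)) y∈Z

  ∈-component-rename : ∀ {x} p r → x ∈ component p (renameRule r) → σ x ∈ component p r
  ∈-component-rename head r = to ∈-map-σ⇔
  ∈-component-rename pos  r = to ∈-map-σ⇔
  ∈-component-rename neg  r = to ∈-map-σ⇔

  componentsAgree-rename : ∀ {Z Z'} → (∀ {x} → x ∈ Z ⇔ σ x ∈ Z') →
                           ∀ r → ComponentsAgree Z Z' r (renameRule r)
  componentsAgree-rename {Z} {Z'} Z⇔Z' r = any⇔ (H r) , all⇔ (B⁺ r) , any⇔ (B⁻ r)
    where
    any⇔ : ∀ L → Any (_∈ Z) L ⇔ Any (_∈ Z') (map σ L)
    any⇔ L = mk⇔ (Anyₚ.map⁺ ∘ Any.map (to Z⇔Z')) (Any.map (from Z⇔Z') ∘ Anyₚ.map⁻)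
    all⇔ : ∀ L → All (_∈ Z) L ⇔ All (_∈ Z') (map σ L)
    all⇔ L = mk⇔ (Allₚ.map⁺ ∘ All.map (to Z⇔Z')) (All.map (from Z⇔Z') ∘ Allₚ.map⁻)

  minimal-rename : ∀ {X T} → Minimal X T → Minimal (map σ X) (rename T)
  minimal-rename {X} {T} minimal Y Y⊆σX σX⊈Y m =
    minimal (map σ Y) σY⊆X X⊈σY (reductModel-transfer⁻ agree m)
    where
    σY⊆X : map σ Y ⊆ X
    σY⊆X = subst (map σ Y ⊆_) (map-σ-involutive X) (⊆.map⁺ σ Y⊆σX)
    X⊈σY : ¬ X ⊆ map σ Y
    X⊈σY X⊆σY = σX⊈Y (subst (map σ X ⊆_) (map-σ-involutive Y) (⊆.map⁺ σ X⊆σY))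
    x∈X⇔σx∈σX : ∀ {x} → x ∈ X ⇔ σ x ∈ map σ X
    x∈X⇔σx∈σX {x} = mk⇔ (∈-map⁺ σ) (subst (_∈ X) (σ-involutive x) ∘ to ∈-map-σ⇔)
    agree : Pointwise (Transferable X (map σ X) (map σ Y) Y) T (rename T)
    agree = pointwise-graph
      (λ r → componentsAgree-rename x∈X⇔σx∈σX r , componentsAgree-rename ∈-map-σ⇔ r) T

  mlnStable-rename : ∀ {X T} → MLNStable X T ⇔ MLNStable (map σ X) (rename T)
  mlnStable-rename {X} {T} = mk⇔ (renamed {X} {T})
    (subst₂ MLNStable (map-σ-involutive X) (rename-involutive T) ∘ renamed {map σ X} {rename T})
    where
    renamed : ∀ {X T} → MLNStable X T → MLNStable (map σ X) (rename T)
    renamed {X} {T} = from mlnStable⇔minimal ∘ minimal-rename {X} {T} ∘ to mlnStable⇔minimal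

transpose : Atom → Atom → Atom → Atom
transpose a c x with x ≟ a | x ≟ c
... | yes _ | _     = c
... | no _  | yes _ = a
... | no _  | no _  = x

transpose-left : ∀ a c → transpose a c a ≡ c
transpose-left a c with a ≟ a
... | yes _  = refl
... | no a≢a = ⊥-elim (a≢a refl)

transpose-right : ∀ a c → transpose a c c ≡ a
transpose-right a c with c ≟ a | c ≟ c
... | yes c≡a | _      = c≡a
... | no _    | yes _  = refl
... | no _    | no c≢c = ⊥-elim (c≢c refl)

transpose-fixes : ∀ {a c x} → x ≢ a → x ≢ c → transpose a c x ≡ x
transpose-fixes {a} {c} {x} x≢a x≢c with x ≟ a | x ≟ c
... | yes x≡a | _       = ⊥-elim (x≢a x≡a)
... | no _    | yes x≡c = ⊥-elim (x≢c x≡c)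
... | no _    | no _    = refl

transpose-involutive : ∀ a c x → transpose a c (transpose a c x) ≡ x
transpose-involutive a c x with x ≟ a | x ≟ c
... | yes refl | _        = transpose-right x c
... | no _     | yes refl = transpose-left a x
... | no x≢a   | no x≢c   = transpose-fixes x≢a x≢c

Avoids : Atom → Rule → Set
Avoids a r = ∀ p → a ∉ component p r

module Transposition (a c : Atom) where
  open Renaming (transpose a c) (transpose-involutive a c) public

  rename-avoiding : ∀ {T} → All (Avoids a) T → All (Avoids c) T → rename T ≡ T
  rename-avoiding a∉T c∉T = map-id-local (All.zipWith (λ (a∉r , c∉r) →
      rule-cong (fixed (a∉r head) (c∉r head))
                (fixed (a∉r pos) (c∉r pos))
                (fixed (a∉r neg) (c∉r neg)))
    (a∉T , c∉T))
    where
    fixed : ∀ {L} → a ∉ L → c ∉ L → map (transpose a c) L ≡ L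
    fixed a∉L c∉L = map-id-local (All.tabulate λ x∈L →
      transpose-fixes (λ { refl → a∉L x∈L }) (λ { refl → c∉L x∈L }))

  avoids-rename : ∀ {T} → All (Avoids c) T → All (Avoids a) (rename T)
  avoids-rename = Allₚ.map⁺ ∘ All.map λ {r} c∉r p a∈r′ →
    c∉r p (subst (_∈ component p r) (transpose-left a c) (∈-component-rename p r a∈r′))

atoms : Program → List Atom
atoms []      = []
atoms (r ∷ T) = H r ++ B⁺ r ++ B⁻ r ++ atoms T

∉atoms⇒avoids : ∀ {c} T → c ∉ atoms T → All (Avoids c) T
∉atoms⇒avoids []      c∉T = []
∉atoms⇒avoids (r ∷ T) c∉T =
  (λ p → c∉T ∘ component⊆atoms p)
  ∷ ∉atoms⇒avoids T (c∉T ∘ ∈-++⁺ʳ (H r) ∘ ∈-++⁺ʳ (B⁺ r) ∘ ∈-++⁺ʳ (B⁻ r))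
  where
  component⊆atoms : ∀ p → component p r ⊆ atoms (r ∷ T)
  component⊆atoms head = ∈-++⁺ˡ
  component⊆atoms pos  = ∈-++⁺ʳ (H r) ∘ ∈-++⁺ˡ
  component⊆atoms neg  = ∈-++⁺ʳ (H r) ∘ ∈-++⁺ʳ (B⁺ r) ∘ ∈-++⁺ˡ

fresh⇒avoids : ∀ {a} T → Fresh T a → All (Avoids a) T
fresh⇒avoids []      fresh = []
fresh⇒avoids (r ∷ T) fresh = fresh zero ∷ fresh⇒avoids T (fresh ∘ suc)

avoids⇒fresh : ∀ {a} T → All (Avoids a) T → Fresh T a
avoids⇒fresh (r ∷ T) (a∉r ∷ a∉T) zero    = a∉r
avoids⇒fresh (r ∷ T) (a∉r ∷ a∉T) (suc k) = avoids⇒fresh T a∉T k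

∉atoms⇒fresh : ∀ {a} T → a ∉ atoms T → Fresh T a
∉atoms⇒fresh T = avoids⇒fresh T ∘ ∉atoms⇒avoids T

freshFor : List Atom → Atom
freshFor L = suc (max 0 L)

freshFor-∉ : ∀ L → freshFor L ∉ L
freshFor-∉ L x∈L = 1+n≰n (All.lookup (xs≤max 0 L) x∈L)

implication : Atom → Atom → Rule
implication u v = rule (u ∷ []) (v ∷ []) []

sat⁺-implication : ∀ {Y u v} → (v ∈ Y → u ∈ Y) → Sat⁺ Y (implication u v)
sat⁺-implication {Y} {u} {v} v⇒u with v ∈? Y
... | yes v∈Y = inj₁ (here (v⇒u v∈Y))
... | no v∉Y  = inj₂ (v∉Y ∘ All.head)

sat⁺-implication⁻ : ∀ {Y u v} → Sat⁺ Y (implication u v) → v ∈ Y → u ∈ Y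
sat⁺-implication⁻ (inj₁ (here u∈Y)) _   = u∈Y
sat⁺-implication⁻ (inj₂ v∉Y)        v∈Y = ⊥-elim (v∉Y (v∈Y ∷ []))

module Duplication (a b : Atom) (b≢a : b ≢ a) where

  data Duplicated (L : List Atom) : List Atom → Set where
    keep : Duplicated L L
    copy : b ∈ L → Duplicated L (a ∷ L)

  DuplicatedRule : Rule → Rule → Set
  DuplicatedRule r r' = Avoids a r × ∀ p → Duplicated (component p r) (component p r')

  Closed : Interp → Set
  Closed Z = a ∈ Z ⇔ b ∈ Z

  AgreeOff : Interp → Interp → Set
  AgreeOff Z Z' = ∀ {x} → x ≢ a → x ∈ Z ⇔ x ∈ Z'

  withCopy : Interp → Interp
  withCopy Z with b ∈? Z
  ... | yes _ = a ∷ Z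
  ... | no _  = Z

  ≢a? : Decidable (_≢ a)
  ≢a? x = ¬? (x ≟ a)

  withoutA : Interp → Interp
  withoutA = filter ≢a?

  bridge : Program
  bridge = implication a b ∷ implication b a ∷ []

  agreeOff-withCopy : ∀ Z → AgreeOff Z (withCopy Z)
  agreeOff-withCopy Z {x} x≢a with b ∈? Z
  ... | yes _ = mk⇔ there λ { (here x≡a) → ⊥-elim (x≢a x≡a) ; (there x∈Z) → x∈Z }
  ... | no _  = ⇔-id _

  closed-withCopy : ∀ {Z} → a ∉ Z → Closed (withCopy Z)
  closed-withCopy {Z} a∉Z with b ∈? Z
  ... | yes b∈Z = mk⇔ (λ _ → there b∈Z) (λ _ → here refl)
  ... | no b∉Z  = mk⇔ (⊥-elim ∘ a∉Z) (⊥-elim ∘ b∉Z)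

  a∉withoutA : ∀ Z → a ∉ withoutA Z
  a∉withoutA Z a∈ = proj₂ (∈-filter⁻ ≢a? {xs = Z} a∈) refl

  agreeOff-withoutA : ∀ Z → AgreeOff (withoutA Z) Z
  agreeOff-withoutA Z x≢a =
    mk⇔ (proj₁ ∘ ∈-filter⁻ ≢a? {xs = Z}) (λ x∈Z → ∈-filter⁺ ≢a? x∈Z x≢a)

  ⊆-lift : ∀ {X X' Y Y'} → Closed X' → Closed Y' →
           AgreeOff X X' → AgreeOff Y Y' → X ⊆ Y → X' ⊆ Y'
  ⊆-lift closedX' closedY' agreeX agreeY X⊆Y {x} x∈X' with x ≟ a
  ... | yes refl = from closedY' (to (agreeY b≢a) (X⊆Y (from (agreeX b≢a) (to closedX' x∈X'))))
  ... | no x≢a   = to (agreeY x≢a) (X⊆Y (from (agreeX x≢a) x∈X'))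

  ⊆-lower : ∀ {X X' Y Y'} → a ∉ X → AgreeOff X X' → AgreeOff Y Y' → X' ⊆ Y' → X ⊆ Y
  ⊆-lower a∉X agreeX agreeY X'⊆Y' x∈X = from (agreeY x≢a) (X'⊆Y' (to (agreeX x≢a) x∈X))
    where x≢a = λ { refl → a∉X x∈X }

  any-duplicated : ∀ {Z L L'} → Closed Z → Duplicated L L' → Any (_∈ Z) L ⇔ Any (_∈ Z) L'
  any-duplicated closed keep       = ⇔-id _
  any-duplicated closed (copy b∈L) =
    mk⇔ there λ { (here a∈Z) → lose b∈L (to closed a∈Z) ; (there p) → p }

  all-duplicated : ∀ {Z L L'} → Closed Z → Duplicated L L' → All (_∈ Z) L ⇔ All (_∈ Z) L'
  all-duplicated closed keep       = ⇔-id _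
  all-duplicated closed (copy b∈L) = mk⇔ (λ ps → from closed (All.lookup ps b∈L) ∷ ps) All.tail

  componentsAgree-duplicated : ∀ {Z Z' r r'} → AgreeOff Z Z' → Closed Z' → DuplicatedRule r r' →
                               ComponentsAgree Z Z' r r'
  componentsAgree-duplicated {Z} {Z'} agree closed (a∉r , dup) =
      any-duplicated closed (dup head) ⇔-∘ any-cong-local (agreeOn (a∉r head))
    , all-duplicated closed (dup pos)  ⇔-∘ all-cong-local (agreeOn (a∉r pos))
    , any-duplicated closed (dup neg)  ⇔-∘ any-cong-local (agreeOn (a∉r neg))
    where
    agreeOn : ∀ {L} → a ∉ L → ∀ {x} → x ∈ L → x ∈ Z ⇔ x ∈ Z'
    agreeOn a∉L x∈L = agree λ { refl → a∉L x∈L }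

  transferable-duplicated : ∀ {X X' Y Y' T T'} →
    AgreeOff X X' → Closed X' → AgreeOff Y Y' → Closed Y' →
    Pointwise DuplicatedRule T T' → Pointwise (Transferable X X' Y Y') T T'
  transferable-duplicated agreeX closedX' agreeY closedY' = Pointwise.map λ dup →
    componentsAgree-duplicated agreeX closedX' dup , componentsAgree-duplicated agreeY closedY' dup

  reductModel-bridge : ∀ {X Y} → Closed Y → ReductModel X Y bridge
  reductModel-bridge closed = (λ _ _ → sat⁺-implication (from closed))
                            ∷ (λ _ _ → sat⁺-implication (to closed)) ∷ []

  closed-of-bridge : ∀ {X Y} → Closed X → ReductModel X Y bridge → Closed Y
  closed-of-bridge closed (a←b ∷ b←a ∷ []) =
    mk⇔ (sat⁺-implication⁻ (b←a (sat-of-sat⁺ (sat⁺-implication (to closed))) λ ()))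
        (sat⁺-implication⁻ (a←b (sat-of-sat⁺ (sat⁺-implication (from closed))) λ ()))

  minimal-duplicate : ∀ {X T T'} → a ∉ X → Pointwise DuplicatedRule T T' →
                      Minimal X T → Minimal (withCopy X) (T' ++ bridge)
  minimal-duplicate {X} {T} {T'} a∉X dup minimal Y' Y'⊆X' X'⊈Y' m =
    minimal Y Y⊆X X⊈Y (reductModel-transfer⁻ agree (Allₚ.++⁻ˡ T' m))
    where
    Y = withoutA Y'
    closedX' = closed-withCopy a∉X
    closedY' = closed-of-bridge closedX' (Allₚ.++⁻ʳ T' m)
    Y⊆X = ⊆-lower (a∉withoutA Y') (agreeOff-withoutA Y') (agreeOff-withCopy X) Y'⊆X'
    X⊈Y = X'⊈Y' ∘ ⊆-lift closedX' closedY' (agreeOff-withCopy X) (agreeOff-withoutA Y')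
    agree = transferable-duplicated (agreeOff-withCopy X) closedX' (agreeOff-withoutA Y') closedY' dup

  minimal-unduplicate : ∀ {X T T'} → a ∉ X → Pointwise DuplicatedRule T T' →
                        Minimal (withCopy X) (T' ++ bridge) → Minimal X T
  minimal-unduplicate {X} a∉X dup minimal Y Y⊆X X⊈Y m =
    minimal Y' Y'⊆X' X'⊈Y' (Allₚ.++⁺ (reductModel-transfer agree m) (reductModel-bridge closedY'))
    where
    Y' = withCopy Y
    closedX' = closed-withCopy a∉X
    closedY' = closed-withCopy (a∉X ∘ Y⊆X)
    Y'⊆X' = ⊆-lift closedY' closedX' (agreeOff-withCopy Y) (agreeOff-withCopy X) Y⊆X
    X'⊈Y' = X⊈Y ∘ ⊆-lower a∉X (agreeOff-withCopy X) (agreeOff-withCopy Y)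
    agree = transferable-duplicated (agreeOff-withCopy X) closedX' (agreeOff-withCopy Y) closedY' dup

  mlnStable-duplicate : ∀ {X T T'} → a ∉ X → Pointwise DuplicatedRule T T' →
                        MLNStable X T ⇔ MLNStable (withCopy X) (T' ++ bridge)
  mlnStable-duplicate {X} {T} {T'} a∉X dup = begin
    MLNStable X T
      ≈⟨ mlnStable⇔minimal ⟩
    Minimal X T
      ≈⟨ mk⇔ (minimal-duplicate a∉X dup) (minimal-unduplicate a∉X dup) ⟩
    Minimal (withCopy X) (T' ++ bridge)
      ≈⟨ mlnStable⇔minimal ⟨
    MLNStable (withCopy X) (T' ++ bridge) ∎

  keep-avoiding : ∀ {T} → All (Avoids a) T → Pointwise DuplicatedRule T T
  keep-avoiding []          = []
  keep-avoiding (a∉r ∷ a∉T) = (a∉r , λ _ → keep) ∷ keep-avoiding a∉T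

  mlnStable-transposed-copy : ∀ {c P P' R X} → c ∉ X →
    All (Avoids a) P → All (Avoids c) P → All (Avoids c) R → Pointwise DuplicatedRule P P' →
    MLNStable X (P ++ R) ⇔
    MLNStable (withCopy (map (transpose a c) X)) (P' ++ (Transposition.rename a c R ++ bridge))
  mlnStable-transposed-copy {c} {P} {P'} {R} {X} c∉X a∉P c∉P c∉R dup = begin
    MLNStable X (P ++ R)
      ≈⟨ mlnStable-rename {X} {P ++ R} ⟩
    MLNStable (map σ X) (rename (P ++ R))
      ≡⟨ cong (MLNStable (map σ X))
              (trans (map-++ renameRule P R) (cong (_++ rename R) (rename-avoiding a∉P c∉P))) ⟩
    MLNStable (map σ X) (P ++ rename R)
      ≈⟨ mlnStable-duplicate a∉σX (Pointwise.++⁺ dup (keep-avoiding (avoids-rename c∉R))) ⟩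
    MLNStable (withCopy (map σ X)) ((P' ++ rename R) ++ bridge)
      ≡⟨ cong (MLNStable (withCopy (map σ X))) (++-assoc P' (rename R) bridge) ⟩
    MLNStable (withCopy (map σ X)) (P' ++ (rename R ++ bridge)) ∎
    where
    open Transposition a c
    σ = transpose a c
    a∉σX : a ∉ map σ X
    a∉σX = c∉X ∘ subst (_∈ X) (transpose-left a c) ∘ to ∈-map-σ⇔

  duplicated-addIf : ∀ B L → (B ≡ true → b ∈ L) → Duplicated L (addIf B a L)
  duplicated-addIf true  L b∈L = copy (b∈L refl)
  duplicated-addIf false L _   = keep

  transform-duplicates : ∀ T N → Fresh T a → (∀ k p → N k p ≡ true → b ∈ S T k p) →
                         Pointwise DuplicatedRule T (transform T N a)
  transform-duplicates []      N fresh selected = []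
  transform-duplicates (r ∷ T) N fresh selected =
    (fresh zero , duplicated) ∷ transform-duplicates T (N ∘ suc) (fresh ∘ suc) (selected ∘ suc)
    where
    duplicated : ∀ p → Duplicated (component p r) (component p (lookup (transform (r ∷ T) N a) zero))
    duplicated head = duplicated-addIf (N zero head) (H r)  (selected zero head)
    duplicated pos  = duplicated-addIf (N zero pos)  (B⁺ r) (selected zero pos)
    duplicated neg  = duplicated-addIf (N zero neg)  (B⁻ r) (selected zero neg)

nsePreserving-1 : NSEPreserving 1
nsePreserving-1 P Q N a ((k , p , Nkp) , (b ∷ [] , _ , refl , indep) , fresh) P≢Q P⊕≡Q⊕ = P≢Q P≡Q
  where
  selected : ∀ k p → N k p ≡ true → b ∈ S (P ++ Q) k p
  selected = proj₁ (to (indep b) (here refl))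
  b≢a : b ≢ a
  b≢a refl = fresh k p (selected k p Nkp)
  open Duplication a b b≢a
  duplicates : Pointwise DuplicatedRule P (leftPart P Q N a)
             × Pointwise DuplicatedRule Q (rightPart P Q N a)
  duplicates = pointwise-split P (transform-duplicates (P ++ Q) N fresh selected)
  a∉PQ : All (Avoids a) P × All (Avoids a) Q
  a∉PQ = Allₚ.++⁻ P (fresh⇒avoids (P ++ Q) fresh)
  P≡Q : SSEquiv P Q
  P≡Q R X = begin
    MLNStable X (P ++ R)
      ≈⟨ mlnStable-transposed-copy c∉X (proj₁ a∉PQ) (proj₁ c∉PQ) c∉R (proj₁ duplicates) ⟩
    MLNStable X' (leftPart P Q N a ++ R')
      ≈⟨ P⊕≡Q⊕ R' X' ⟩
    MLNStable X' (rightPart P Q N a ++ R')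
      ≈⟨ mlnStable-transposed-copy c∉X (proj₂ a∉PQ) (proj₂ c∉PQ) c∉R (proj₂ duplicates) ⟨
    MLNStable X (Q ++ R) ∎
    where
    occupied = X ++ atoms ((P ++ Q) ++ R)
    c = freshFor occupied
    c∉X : c ∉ X
    c∉X = freshFor-∉ occupied ∘ ∈-++⁺ˡ
    c∉PQR : All (Avoids c) (P ++ Q) × All (Avoids c) R
    c∉PQR = Allₚ.++⁻ (P ++ Q)
              (∉atoms⇒avoids ((P ++ Q) ++ R) (freshFor-∉ occupied ∘ ∈-++⁺ʳ X))
    c∉PQ : All (Avoids c) P × All (Avoids c) Q
    c∉PQ = Allₚ.++⁻ P (proj₁ c∉PQR)
    c∉R : All (Avoids c) R
    c∉R = proj₂ c∉PQR
    X' = withCopy (map (transpose a c) X)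
    R' = Transposition.rename a c R ++ bridge

sat⁺? : ∀ Y → Decidable (Sat⁺ Y)
sat⁺? Y r = any? (_∈? Y) (H r) ⊎-dec ¬? (all? (_∈? Y) (B⁺ r))

reductModel? : ∀ X Y T → Dec (ReductModel X Y T)
reductModel? X Y = all? λ r → sat? X r →-dec notBlocked? X r →-dec sat⁺? Y r

all-parts? : ∀ {P : Part → Set} → (∀ p → Dec (P p)) → Dec (∀ p → P p)
all-parts? P? = map′ (λ (h , p , n) → λ { head → h ; pos → p ; neg → n })
                     (λ P∀ → P∀ head , P∀ pos , P∀ neg)
                     (P? head ×-dec P? pos ×-dec P? neg)

inIndep? : ∀ T N → Decidable (InIndep T N)
inIndep? T N x = all-cells? (λ k p → (N k p Bool.≟ true) →-dec (x ∈? S T k p))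
           ×-dec all-cells? (λ k p → (N k p Bool.≟ false) →-dec ¬? (x ∈? S T k p))
  where
  all-cells? : ∀ {P : Fin (length T) → Part → Set} →
               (∀ k p → Dec (P k p)) → Dec (∀ k p → P k p)
  all-cells? P? = Fin.all? λ k → all-parts? (P? k)

indepCard-0 : ∀ T N k p → N k p ≡ true → (∀ {x} → x ∉ S T k p) → IndepCard T N 0
indepCard-0 T N k p Nkp empty =
  [] , [] , refl , λ x → mk⇔ (λ ()) λ (selected , _) → ⊥-elim (empty (selected k p Nkp))

fact : Atom → Rule
fact x = rule (x ∷ []) [] []

sat⁺-fact⁻ : ∀ {Y x} → Sat⁺ Y (fact x) → x ∈ Y
sat⁺-fact⁻ (inj₁ (here x∈Y)) = x∈Y
sat⁺-fact⁻ (inj₂ ¬[])       = ⊥-elim (¬[] [])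

mlnStable-facts : ∀ X T → (∀ {x} → x ∈ X → fact x ∈ T) → MLNStable X T
mlnStable-facts X T facts = from mlnStable⇔minimal λ Y Y⊆X X⊈Y m →
  X⊈Y λ x∈X → sat⁺-fact⁻ (All.lookup m (facts x∈X) (inj₁ (here x∈X)) λ ())

sat⁺-tautology : ∀ {Y x} r → x ∈ H r → x ∈ B⁺ r → Sat⁺ Y r
sat⁺-tautology {Y} {x} r x∈H x∈B⁺ with x ∈? Y
... | yes x∈Y = inj₁ (lose x∈H x∈Y)
... | no x∉Y  = inj₂ (λ B⁺⊆Y → x∉Y (All.lookup B⁺⊆Y x∈B⁺))

¬sePreserving-0 : ¬ SEPreserving 0
¬sePreserving-0 sep = ¬stable (to (sep P P N 0 admissible (λ _ _ → ⇔-id _) [] (0 ∷ [])) stable)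
  where
  P : Program
  P = rule [] [] [] ∷ []
  N : IndexSet (P ++ P)
  N zero head = true
  N _    _    = false
  admissible : Admissible 0 P P N 0
  admissible = (zero , head , refl)
             , indepCard-0 (P ++ P) N zero head refl (λ ())
             , ∉atoms⇒fresh (P ++ P) (λ ())
  stable : MLNStable (0 ∷ []) (fact 0 ∷ [])
  stable = mlnStable-facts (0 ∷ []) (fact 0 ∷ []) λ { (here refl) → here refl }
  ¬stable : ¬ MLNStable (0 ∷ []) P
  ¬stable = reductModel⇒¬mlnStable (0 ∷ []) P [] (λ ()) ⊆.∷⊈[]
    (toWitness {a? = reductModel? (0 ∷ []) [] P} _)

¬nsePreserving-0 : ¬ NSEPreserving 0
¬nsePreserving-0 nse = nse P [] N 1 admissible P≢[] P⊕≡[]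
  where
  P : Program
  P = fact 0 ∷ []
  N : IndexSet (P ++ [])
  N zero neg = false
  N zero _   = true
  admissible : Admissible 0 P [] N 1
  admissible = (zero , head , refl)
             , indepCard-0 (P ++ []) N zero pos refl (λ ())
             , ∉atoms⇒fresh (P ++ []) (toWitnessFalse {a? = 1 ∈? atoms P} _)
  P≢[] : ¬ SSEquiv P []
  P≢[] P≡[] = reductModel⇒¬mlnStable (0 ∷ []) [] [] (λ ()) ⊆.∷⊈[] []
    (to (P≡[] [] (0 ∷ [])) (mlnStable-facts (0 ∷ []) (P ++ []) λ { (here refl) → here refl }))
  tautology : Rule
  tautology = rule (1 ∷ 0 ∷ []) (1 ∷ []) []
  P⊕≡[] : SSEquiv (leftPart P [] N 1) []
  P⊕≡[] = ssEquiv-of-reductModels {tautology ∷ []} {[]} (λ _ _ → [])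
    (λ _ _ → (λ _ _ → sat⁺-tautology tautology (here refl) (here refl)) ∷ [])

¬sePreserving-1 : ¬ SEPreserving 1
¬sePreserving-1 sep = ¬stable (to (sep P Q N 2 admissible P≡Q R X) stable)
  where
  P Q R P⊕ Q⊕ : Program
  P = fact 0 ∷ rule (0 ∷ 1 ∷ []) [] [] ∷ []
  Q = implication 0 1 ∷ rule (0 ∷ 1 ∷ []) [] [] ∷ []
  R = fact 1 ∷ []
  -- P⊕ and Q⊕ are leftPart P Q N 2 and rightPart P Q N 2, up to computation.
  P⊕ = fact 0 ∷ rule (2 ∷ 0 ∷ 1 ∷ []) [] [] ∷ []
  Q⊕ = rule (0 ∷ []) (2 ∷ 1 ∷ []) [] ∷ rule (2 ∷ 0 ∷ 1 ∷ []) [] [] ∷ []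
  X : Interp
  X = 0 ∷ 1 ∷ []
  N : IndexSet (P ++ Q)
  N (suc zero)             head = true
  N (suc (suc zero))       pos  = true
  N (suc (suc (suc zero))) head = true
  N _                      _    = false
  only-1 : ∀ x → InIndep (P ++ Q) N x → x ∈ 1 ∷ []
  only-1 x (selected , unselected) with selected (suc zero) head refl
  ... | here refl         = ⊥-elim (unselected zero head refl (here refl))
  ... | there (here refl) = here refl
  admissible : Admissible 1 P Q N 2
  admissible = (suc zero , head , refl)
             , (1 ∷ [] , [] ∷ [] , refl , λ x →
                 mk⇔ (λ { (here refl) → toWitness {a? = inIndep? (P ++ Q) N 1} _ }) (only-1 x))
             , ∉atoms⇒fresh (P ++ Q) (toWitnessFalse {a? = 2 ∈? atoms (P ++ Q)} _)
  P⇒Q : ∀ {X Y} → Y ⊆ X → ReductModel X Y P → ReductModel X Y Q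
  P⇒Q {X} {Y} Y⊆X (fact0 ∷ either ∷ []) = if-1-then-0 ∷ either ∷ []
    where
    if-1-then-0 : ReductSat X Y (implication 0 1)
    if-1-then-0 (inj₁ (here 0∈X)) _ = inj₁ (here (sat⁺-fact⁻ (fact0 (inj₁ (here 0∈X)) λ ())))
    if-1-then-0 (inj₂ (inj₁ 1∉X)) _ = inj₂ (1∉X ∘ All.map Y⊆X)
  Q⇒P : ∀ {X Y} → Y ⊆ X → ReductModel X Y Q → ReductModel X Y P
  Q⇒P {X} {Y} _ (if-1-then-0 ∷ either ∷ []) = fact0 ∷ either ∷ []
    where
    fact0 : ReductSat X Y (fact 0)
    fact0 (inj₁ (here 0∈X)) _ with either (inj₁ (here 0∈X)) (λ ())
    ... | inj₁ (here 0∈Y)         = inj₁ (here 0∈Y)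
    ... | inj₁ (there (here 1∈Y)) =
      inj₁ (here (sat⁺-implication⁻ (if-1-then-0 (inj₁ (here 0∈X)) λ ()) 1∈Y))
    ... | inj₂ ¬[]                = ⊥-elim (¬[] [])
    fact0 (inj₂ (inj₁ ¬[])) _ = ⊥-elim (¬[] [])
  P≡Q : SSEquiv P Q
  P≡Q = ssEquiv-of-reductModels {P} {Q} P⇒Q Q⇒P
  stable : MLNStable X (P⊕ ++ R)
  stable = mlnStable-facts X (P⊕ ++ R) λ where
    (here refl)         → here refl
    (there (here refl)) → there (there (here refl))
  ¬stable : ¬ MLNStable X (Q⊕ ++ R)
  ¬stable = reductModel⇒¬mlnStable X (Q⊕ ++ R) (1 ∷ []) (λ { (here refl) → there (here refl) })
    (λ X⊆1 → 0∉1 (X⊆1 (here refl))) (toWitness {a? = reductModel? X (1 ∷ []) (Q⊕ ++ R)} _)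
    where
    0∉1 : 0 ∉ 1 ∷ []
    0∉1 (here ())
    0∉1 (there ())

theorem6 : ¬ SEPreserving 0 × ¬ NSEPreserving 0 × NSEPreserving 1 × ¬ SEPreserving 1
theorem6 = ¬sePreserving-0 , ¬nsePreserving-0 , nsePreserving-1 , ¬sePreserving-1
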